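{- Let $R$ and $S$ be binary relations on a set $D$ that are preserved by a totally symmetric function $f_n:D^n\to D$ of arity $n\ge1$. If there is an alternating closed walk on $R$ and $S$ of length $2n$, then $R\cap S^{ -1}\neq\emptyset$.
   Context: A function $f:D^n\to D$ is totally symmetric if $f(x_1,\dots,x_n)=f(y_1,\dots,y_n)$ whenever $\{x_1,\dots,x_n\}=\{y_1,\dots,y_n\}$; it preserves a binary relation $R$ if $(a_i,b_i)\in R$ for $i=1,\dots,n$ implies $(f(a_1,\dots,a_n),f(b_1,\dots,b_n))\in R$. An alternating closed walk on $R$ and $S$ of length $2n$ is a sequence $(x_0,x_1,\dots,x_{2n})$ with $x_{2n}=x_0$, $(x_{2i},x_{2i+1})\in R$ and $(x_{2i+1},x_{2i+2})\in S$ for $0\le i<n$. $S^{ -1}=\{(y,x)\mid (x,y)\in S\}$. -}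

module Defs where

open import Level using (Level)
open import Data.Nat using (ℕ; suc; _*_; _<_; _≥_)
open import Data.Fin using (Fin)
open import Data.Product using (_×_; ∃)
open import Relation.Binary.PropositionalEquality using (_≡_)
open import Relation.Binary.Core using (Rel)

private variable a ℓ : Level

SameSet : {D : Set a} {n : ℕ} → (Fin n → D) → (Fin n → D) → Set a
SameSet x y = (∀ i → ∃ λ j → x i ≡ y j) × (∀ j → ∃ λ i → y j ≡ x i)

TotallySymmetric : {D : Set a} {n : ℕ} → ((Fin n → D) → D) → Set a
TotallySymmetric f = ∀ x y → SameSet x y → f x ≡ f y

Preserves : {D : Set a} {n : ℕ} → ((Fin n → D) → D) → Rel D ℓ → Set (a Level.⊔ ℓ)
Preserves f R = ∀ x y → (∀ i → R (x i) (y i)) → R (f x) (f y)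

-- (x₀,…,x_{2n}) is an alternating closed walk on R and S of length 2n
-- (only the values x 0 … x (2n) of the sequence matter)
AltClosedWalk : {D : Set a} → Rel D ℓ → Rel D ℓ → (n : ℕ) → (ℕ → D) → Set (a Level.⊔ ℓ)
AltClosedWalk R S n x =
  (x (2 * n) ≡ x 0) ×
  (∀ i → i < n → R (x (2 * i)) (x (suc (2 * i))) × S (x (suc (2 * i))) (x (suc (suc (2 * i)))))

module Submission where

-- Split the closed walk into the tuples of its even points a, odd points b and
-- shifted even points c, so that R (aᵢ, bᵢ) and S (bᵢ, cᵢ) hold coordinatewise.
-- Closing the walk makes c a cyclic rotation of a, so f c = f a by total symmetry,
-- and preservation gives R (f a, f b) and S (f b, f c) = S (f b, f a).

open import Defs
open import Level using (Level)
open import Function using (_∘_)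
open import Data.Nat using (ℕ; _≥_; suc; _*_)
open import Data.Nat.Properties using (*-suc)
open import Data.Fin using (Fin; zero; suc; toℕ; fromℕ; inject₁)
open import Data.Fin.Properties using (toℕ<n; toℕ-inject₁; toℕ-fromℕ)
open import Data.Fin.Relation.Unary.Top using (view; ‵fromℕ; ‵inject₁)
open import Data.Product using (_×_; ∃; ∃₂; _,_; proj₁; proj₂)
open import Relation.Binary.Core using (Rel)
open import Relation.Binary.PropositionalEquality using (_≡_; sym; trans; cong; subst)

private
  variable
    a ℓ : Level
    D : Set a

rotate-sameSet : ∀ {m} (x : ℕ → D) → x (suc m) ≡ x 0 →
  SameSet (λ (i : Fin (suc m)) → x (suc (toℕ i))) (λ i → x (toℕ i))
rotate-sameSet {m = m} x closed = forward , backward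
  where
  last-wraps : x (suc (toℕ (fromℕ m))) ≡ x 0
  last-wraps = trans (cong (x ∘ suc) (toℕ-fromℕ m)) closed

  forward : ∀ i → ∃ λ j → x (suc (toℕ i)) ≡ x (toℕ j)
  forward i with view i
  ... | ‵fromℕ     = zero , last-wraps
  ... | ‵inject₁ k = suc k , cong (x ∘ suc) (toℕ-inject₁ k)

  backward : ∀ j → ∃ λ i → x (toℕ j) ≡ x (suc (toℕ i))
  backward zero    = fromℕ m , sym last-wraps
  backward (suc k) = inject₁ k , sym (cong (x ∘ suc) (toℕ-inject₁ k))

totallySymmetric⇒R∩S⁻¹ : ∀ {n} {R S : Rel D ℓ} {f : (Fin n → D) → D} →
  TotallySymmetric f → Preserves f R → Preserves f S →
  (u v w : Fin n → D) → (∀ i → R (u i) (v i)) → (∀ i → S (v i) (w i)) → SameSet w u →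
  R (f u) (f v) × S (f v) (f u)
totallySymmetric⇒R∩S⁻¹ {S = S} {f} symm pres-R pres-S u v w uRv vSw w≈u =
  pres-R u v uRv , subst (S (f v)) (symm w u w≈u) (pres-S v w vSw)

module AltClosedWalkSteps (R S : Rel D ℓ) (n : ℕ) (x : ℕ → D) (walk : AltClosedWalk R S n x) where

  walk-R : ∀ (i : Fin n) → R (x (2 * toℕ i)) (x (suc (2 * toℕ i)))
  walk-R i = proj₁ (proj₂ walk (toℕ i) (toℕ<n i))

  walk-S : ∀ (i : Fin n) → S (x (suc (2 * toℕ i))) (x (2 * suc (toℕ i)))
  walk-S i = subst (S (x (suc (2 * toℕ i))) ∘ x) (sym (*-suc 2 (toℕ i)))
                   (proj₂ (proj₂ walk (toℕ i) (toℕ<n i)))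

lemma3p13 : ∀ {a ℓ : Level} {D : Set a} (R S : Rel D ℓ) (n : ℕ) → n ≥ 1 →
    (f : (Fin n → D) → D) → TotallySymmetric f → Preserves f R → Preserves f S →
    (∃ λ (x : ℕ → D) → AltClosedWalk R S n x) →
    ∃₂ λ (u v : D) → R u v × S v u
lemma3p13 {D = D} R S (suc m) _ f symm pres-R pres-S (x , walk) =
  f evens , f odds ,
  totallySymmetric⇒R∩S⁻¹ {R = R} {S = S} symm pres-R pres-S evens odds shifted-evens
    walk-R walk-S (rotate-sameSet (x ∘ (2 *_)) (proj₁ walk))
  where
  open AltClosedWalkSteps R S (suc m) x walk
  evens odds shifted-evens : Fin (suc m) → D
  evens i         = x (2 * toℕ i)
  odds i          = x (suc (2 * toℕ i))
  shifted-evens i = x (2 * suc (toℕ i))
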